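{- Let $n\ge2$ and $m\ge 0$ be integers with $n\le 2^m$. Then $u_1,\ldots,u_n$ are pairwise incongruent modulo $2^m$.
   Context: The Salajan sequence is $u_1,u_2,\ldots$ with $u_j=(3^j-5(-1)^j)/4$ for $j\ge1$. -}

module Defs where

open import Data.Nat using (ℕ; suc)
open import Data.Integer using (ℤ; +_; -_; _-_; _*_; _^_; _/_)

sgn : ℕ → ℤ
sgn j = (- (+ 1)) ^ j

-- Salajan sequence: u j = (3^j - 5 (-1)^j) / 4  (exact division for j ≥ 1)
u : ℕ → ℤ
u j = ((+ 3) ^ j - (+ 5) * sgn j) / (+ 4)

-- With R a = (9 ^ a - 1) / 8 one has u (1 + 2a) = 2 + 6 R a and u (2 + 2a) = 1 + 18 R a,
-- so indices of different parity give values of different parity. For indices of the same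
-- parity the difference is 2 · odd · 9 ^ a · R d with d the distance of the half-indices, and
-- the 2-adic valuation of R d equals that of d: R d ≡ d (mod 2) and R (2e) = 2 · R e · odd.
-- Since 0 < d < 2 ^ (m - 1), the difference has valuation below m.
module Submission where

open import Defs
open import Data.Nat using (ℕ; zero; suc; _+_; _*_; _∸_; _<_; _≤_; ∣_-_∣; >-nonZero)
  renaming (_^_ to _^ℕ_)
open import Data.Nat.Properties
open import Data.Nat.Divisibility
  using (_∣_; divides; ∣-refl; 1∣_; ∣m∣n⇒∣m+n; ∣m+n∣m⇒∣n; ∣m⇒∣m*n; m∣m*n; m*n∣⇒m∣;
         *-monoʳ-∣; *-cancelˡ-∣; >⇒∤)
open import Data.Nat.DivMod using (_/_; m*n/n≡m)
open import Data.Nat.Tactic.RingSolver as ℕ-Ring using ()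
open import Data.Integer as ℤ using (+_; -_; _⊖_)
open import Data.Integer.DivMod using (div-pos-is-/ℕ)
open import Data.Integer.Properties as ℤ using (pos-+; pos-*; m-n≡m⊖n; [1+m]⊖[1+n]≡m⊖n)
open import Data.Integer.Tactic.RingSolver as ℤ-Ring using ()
import Data.Integer.Divisibility as ℤ
open import Data.Sum using (inj₁; inj₂)
open import Data.Empty using (⊥-elim)
open import Function using (_∘_)
open import Relation.Binary.PropositionalEquality
open import Relation.Binary.Definitions using (tri<; tri≈; tri>)
open import Relation.Nullary using (¬_)

open ≡-Reasoning

data Half : ℕ → Set where
  even : ∀ a → Half (2 * a)
  odd  : ∀ a → Half (1 + 2 * a)

half : ∀ k → Half k
half zero = even 0
half (suc k) with half k
... | even a = odd a
... | odd a  = subst Half (cong suc (+-suc a (a + 0))) (even (suc a))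

2∤1+2n : ∀ n → ¬ 2 ∣ 1 + 2 * n
2∤1+2n n (divides q eq) = even≢odd q n (trans (*-comm 2 q) (sym eq))

2∣odd*n⇒2∣n : ∀ t n → 2 ∣ (1 + 2 * t) * n → 2 ∣ n
2∣odd*n⇒2∣n t n 2∣odd*n =
  ∣m+n∣m⇒∣n (subst (2 ∣_) (+-comm n (2 * t * n)) 2∣odd*n) (∣m⇒∣m*n n (m∣m*n t))

2^k∣odd*n⇒2^k∣n : ∀ k t n → 2 ^ℕ k ∣ (1 + 2 * t) * n → 2 ^ℕ k ∣ n
2^k∣odd*n⇒2^k∣n zero    t n _ = 1∣ n
2^k∣odd*n⇒2^k∣n (suc k) t n 2^[1+k]∣ with 2∣odd*n⇒2∣n t n (m*n∣⇒m∣ 2 (2 ^ℕ k) 2^[1+k]∣)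
... | divides h refl = subst (2 ^ℕ suc k ∣_) (*-comm 2 h)
  (*-monoʳ-∣ 2 (2^k∣odd*n⇒2^k∣n k t h (*-cancelˡ-∣ 2 (subst (2 ^ℕ suc k ∣_) (regroup t h) 2^[1+k]∣))))
  where
  regroup : ∀ t h → (1 + 2 * t) * (h * 2) ≡ 2 * ((1 + 2 * t) * h)
  regroup = ℕ-Ring.solve-∀

-- repunit c e = 1 + q + ⋯ + q ^ (e - 1) in base q = 1 + 4c.
repunit : ℕ → ℕ → ℕ
repunit c zero    = 0
repunit c (suc e) = 1 + (1 + 4 * c) * repunit c e

repunit-pow : ∀ c e → (1 + 4 * c) ^ℕ e ≡ 1 + 2 * (2 * c * repunit c e)
repunit-pow c zero    = cong (λ x → 1 + 2 * x) (sym (*-zeroʳ (2 * c)))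
repunit-pow c (suc e) = begin
  (1 + 4 * c) * (1 + 4 * c) ^ℕ e               ≡⟨ cong ((1 + 4 * c) *_) (repunit-pow c e) ⟩
  (1 + 4 * c) * (1 + 2 * (2 * c * repunit c e)) ≡⟨ expand c (repunit c e) ⟩
  1 + 2 * (2 * c * repunit c (suc e))           ∎
  where
  expand : ∀ c r → (1 + 4 * c) * (1 + 2 * (2 * c * r)) ≡ 1 + 2 * (2 * c * (1 + (1 + 4 * c) * r))
  expand = ℕ-Ring.solve-∀

repunit-+ : ∀ c a d → repunit c (a + d) ≡ repunit c a + (1 + 4 * c) ^ℕ a * repunit c d
repunit-+ c zero    d = sym (*-identityˡ (repunit c d))
repunit-+ c (suc a) d = begin
  1 + q * repunit c (a + d)               ≡⟨ cong (λ r → 1 + q * r) (repunit-+ c a d) ⟩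
  1 + q * (repunit c a + p * repunit c d) ≡⟨ distrib q (repunit c a) p (repunit c d) ⟩
  1 + q * repunit c a + q * p * repunit c d ∎
  where
  distrib : ∀ q r p s → 1 + q * (r + p * s) ≡ 1 + q * r + q * p * s
  distrib = ℕ-Ring.solve-∀
  q = 1 + 4 * c
  p = q ^ℕ a

repunit-double : ∀ c e → repunit c (2 * e) ≡ 2 * ((1 + 2 * (c * repunit c e)) * repunit c e)
repunit-double c e = begin
  repunit c (e + (e + 0))
    ≡⟨ cong (λ x → repunit c (e + x)) (+-identityʳ e) ⟩
  repunit c (e + e)
    ≡⟨ repunit-+ c e e ⟩
  repunit c e + (1 + 4 * c) ^ℕ e * repunit c e
    ≡⟨ cong (λ p → repunit c e + p * repunit c e) (repunit-pow c e) ⟩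
  repunit c e + (1 + 2 * (2 * c * repunit c e)) * repunit c e
    ≡⟨ factor c (repunit c e) ⟩
  2 * ((1 + 2 * (c * repunit c e)) * repunit c e) ∎
  where
  factor : ∀ c r → r + (1 + 2 * (2 * c * r)) * r ≡ 2 * ((1 + 2 * (c * r)) * r)
  factor = ℕ-Ring.solve-∀

2∣repunit+n : ∀ c d → 2 ∣ repunit c d + d
2∣repunit+n c zero    = divides 0 refl
2∣repunit+n c (suc d) = subst (2 ∣_) (sym (split c (repunit c d) d))
  (∣m∣n⇒∣m+n (m∣m*n (1 + 2 * c * repunit c d)) (2∣repunit+n c d))
  where
  split : ∀ c r d → 1 + (1 + 4 * c) * r + suc d ≡ 2 * (1 + 2 * c * r) + (r + d)
  split = ℕ-Ring.solve-∀

2∣repunit⇒2∣ : ∀ c d → 2 ∣ repunit c d → 2 ∣ d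
2∣repunit⇒2∣ c d = ∣m+n∣m⇒∣n (2∣repunit+n c d)

2^k∣repunit⇒2^k∣ : ∀ c k d → 2 ^ℕ k ∣ repunit c d → 2 ^ℕ k ∣ d
2^k∣repunit⇒2^k∣ c zero    d _ = 1∣ d
2^k∣repunit⇒2^k∣ c (suc k) d 2^[1+k]∣ with half d
... | odd e  = ⊥-elim (2∤1+2n e (2∣repunit⇒2∣ c _ (m*n∣⇒m∣ 2 (2 ^ℕ k) 2^[1+k]∣)))
... | even e = *-monoʳ-∣ 2 (2^k∣repunit⇒2^k∣ c k e
  (2^k∣odd*n⇒2^k∣n k (c * repunit c e) (repunit c e)
    (*-cancelˡ-∣ 2 (subst (2 ^ℕ suc k ∣_) (repunit-double c e) 2^[1+k]∣))))

∣-∣-∣⇒∣ : ∀ {d m n} → d ∣ ∣ m - n ∣ → d ∣ m → d ∣ n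
∣-∣-∣⇒∣ {d} {m} {n} d∣∣m-n∣ d∣m with ≤-total m n
... | inj₁ m≤n = subst (d ∣_) (m+[n∸m]≡n m≤n)
                   (∣m∣n⇒∣m+n d∣m (subst (d ∣_) (m≤n⇒∣m-n∣≡n∸m m≤n) d∣∣m-n∣))
... | inj₂ n≤m = ∣m+n∣m⇒∣n (subst (d ∣_) (sym (m∸n+n≡m n≤m)) d∣m)
                   (subst (d ∣_) (m≤n⇒∣n-m∣≡n∸m n≤m) d∣∣m-n∣)

∣affine-repunit-distance∣ : ∀ c s k a d →
  ∣ s + k * repunit c a - s + k * repunit c (a + d) ∣ ≡ k * ((1 + 4 * c) ^ℕ a * repunit c d)
∣affine-repunit-distance∣ c s k a d = begin
  ∣ s + k * repunit c a - s + k * repunit c (a + d) ∣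
    ≡⟨ cong (λ r → ∣ s + k * repunit c a - s + k * r ∣) (repunit-+ c a d) ⟩
  ∣ s + k * repunit c a - s + k * (repunit c a + (1 + 4 * c) ^ℕ a * repunit c d) ∣
    ≡⟨ cong (λ x → ∣ s + k * repunit c a - x ∣) (distrib s k (repunit c a) _) ⟩
  ∣ s + k * repunit c a - s + k * repunit c a + k * ((1 + 4 * c) ^ℕ a * repunit c d) ∣
    ≡⟨ ∣m-m+n∣≡n (s + k * repunit c a) _ ⟩
  k * ((1 + 4 * c) ^ℕ a * repunit c d) ∎
  where
  distrib : ∀ s k r x → s + k * (r + x) ≡ s + k * r + k * x
  distrib = ℕ-Ring.solve-∀

affine-repunit-separates-< : ∀ c t s m a b → a < b → b < 2 ^ℕ m →
  ¬ 2 ^ℕ suc m ∣ ∣ s + 2 * (1 + 2 * t) * repunit c a - s + 2 * (1 + 2 * t) * repunit c b ∣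
affine-repunit-separates-< c t s m a b a<b b<2^m =
  subst (λ b → ¬ 2 ^ℕ suc m ∣ ∣ f a - f b ∣) (m+[n∸m]≡n (<⇒≤ a<b))
    (>⇒∤ {{>-nonZero (m<n⇒0<n∸m a<b)}} (≤-<-trans (m∸n≤m b a) b<2^m)
      ∘ 2^k∣repunit⇒2^k∣ c m (b ∸ a) ∘ 2^m∣repunit (b ∸ a))
  where
  f : ℕ → ℕ
  f x = s + 2 * (1 + 2 * t) * repunit c x

  2^m∣repunit : ∀ d → 2 ^ℕ suc m ∣ ∣ f a - f (a + d) ∣ → 2 ^ℕ m ∣ repunit c d
  2^m∣repunit d 2^[1+m]∣ = 2^k∣odd*n⇒2^k∣n m (2 * c * repunit c a) (repunit c d)
      (subst (λ p → 2 ^ℕ m ∣ p * repunit c d) (repunit-pow c a)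
        (2^k∣odd*n⇒2^k∣n m t _ (*-cancelˡ-∣ 2 2^[1+m]∣distance)))
    where
    2^[1+m]∣distance : 2 ^ℕ suc m ∣ 2 * ((1 + 2 * t) * ((1 + 4 * c) ^ℕ a * repunit c d))
    2^[1+m]∣distance = subst (2 ^ℕ suc m ∣_)
      (trans (∣affine-repunit-distance∣ c s (2 * (1 + 2 * t)) a d) (*-assoc 2 (1 + 2 * t) _)) 2^[1+m]∣

affine-repunit-separates : ∀ c t s m a b → a ≢ b → a < 2 ^ℕ m → b < 2 ^ℕ m →
  ¬ 2 ^ℕ suc m ∣ ∣ s + 2 * (1 + 2 * t) * repunit c a - s + 2 * (1 + 2 * t) * repunit c b ∣
affine-repunit-separates c t s m a b a≢b a<2^m b<2^m with <-cmp a b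
... | tri≈ _ a≡b _ = λ _ → a≢b a≡b
... | tri< a<b _ _ = affine-repunit-separates-< c t s m a b a<b b<2^m
... | tri> _ _ b<a = affine-repunit-separates-< c t s m b a b<a a<2^m
                       ∘ subst (2 ^ℕ suc m ∣_) (∣-∣-comm (s + k * repunit c a) (s + k * repunit c b))
  where k = 2 * (1 + 2 * t)

pos-^ : ∀ m e → (+ m) ℤ.^ e ≡ + (m ^ℕ e)
pos-^ m zero    = refl
pos-^ m (suc e) = trans (cong (+ m ℤ.*_) (pos-^ m e)) (sym (pos-* m (m ^ℕ e)))

pos-affine : ∀ a b x → + (a + b * x) ≡ + a ℤ.+ + b ℤ.* + x
pos-affine a b x = trans (pos-+ a (b * x)) (cong (λ y → + a ℤ.+ y) (pos-* b x))

3^[2a] : ∀ a → (+ 3) ℤ.^ (2 * a) ≡ + 1 ℤ.+ + 8 ℤ.* + repunit 2 a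
3^[2a] a = begin
  (+ 3) ℤ.^ (2 * a)              ≡⟨ sym (ℤ.^-*-assoc (+ 3) 2 a) ⟩
  (+ 9) ℤ.^ a                    ≡⟨ pos-^ 9 a ⟩
  + (9 ^ℕ a)                     ≡⟨ cong +_ (repunit-pow 2 a) ⟩
  + (1 + 2 * (4 * repunit 2 a))  ≡⟨ cong (λ x → + (1 + x)) (sym (*-assoc 2 4 (repunit 2 a))) ⟩
  + (1 + 8 * repunit 2 a)        ≡⟨ pos-affine 1 8 (repunit 2 a) ⟩
  + 1 ℤ.+ + 8 ℤ.* + repunit 2 a  ∎

sgn[2a] : ∀ a → sgn (2 * a) ≡ + 1
sgn[2a] a = trans (sym (ℤ.^-*-assoc (- + 1) 2 a)) (ℤ.^-zeroˡ a)

u≡quarter : ∀ j x → (+ 3) ℤ.^ j ℤ.- + 5 ℤ.* sgn j ≡ + x ℤ.* + 4 → u j ≡ + x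
u≡quarter j x numerator = begin
  u j                   ≡⟨ cong (ℤ._/ + 4) numerator ⟩
  (+ x ℤ.* + 4) ℤ./ + 4 ≡⟨ cong (ℤ._/ + 4) (sym (pos-* x 4)) ⟩
  + (x * 4) ℤ./ + 4     ≡⟨ div-pos-is-/ℕ (+ (x * 4)) 4 ⟩
  + (x * 4 / 4)         ≡⟨ cong +_ (m*n/n≡m x 4) ⟩
  + x                   ∎

u[1+2a] : ∀ a → u (1 + 2 * a) ≡ + (2 + 6 * repunit 2 a)
u[1+2a] a = u≡quarter (1 + 2 * a) _ (begin
  + 3 ℤ.* (+ 3) ℤ.^ (2 * a) ℤ.- + 5 ℤ.* (- + 1 ℤ.* sgn (2 * a))
    ≡⟨ cong₂ (λ p q → + 3 ℤ.* p ℤ.- + 5 ℤ.* (- + 1 ℤ.* q)) (3^[2a] a) (sgn[2a] a) ⟩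
  + 3 ℤ.* (+ 1 ℤ.+ + 8 ℤ.* R) ℤ.- + 5 ℤ.* (- + 1 ℤ.* + 1)
    ≡⟨ expand R ⟩
  (+ 2 ℤ.+ + 6 ℤ.* R) ℤ.* + 4
    ≡⟨ cong (ℤ._* + 4) (sym (pos-affine 2 6 (repunit 2 a))) ⟩
  + (2 + 6 * repunit 2 a) ℤ.* + 4 ∎)
  where
  R = + repunit 2 a
  expand : ∀ R → + 3 ℤ.* (+ 1 ℤ.+ + 8 ℤ.* R) ℤ.- + 5 ℤ.* (- + 1 ℤ.* + 1) ≡ (+ 2 ℤ.+ + 6 ℤ.* R) ℤ.* + 4
  expand = ℤ-Ring.solve-∀

u[2+2a] : ∀ a → u (2 + 2 * a) ≡ + (1 + 18 * repunit 2 a)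
u[2+2a] a = u≡quarter (2 + 2 * a) _ (begin
  + 3 ℤ.* (+ 3 ℤ.* (+ 3) ℤ.^ (2 * a)) ℤ.- + 5 ℤ.* (- + 1 ℤ.* (- + 1 ℤ.* sgn (2 * a)))
    ≡⟨ cong₂ (λ p q → + 3 ℤ.* (+ 3 ℤ.* p) ℤ.- + 5 ℤ.* (- + 1 ℤ.* (- + 1 ℤ.* q))) (3^[2a] a) (sgn[2a] a) ⟩
  + 3 ℤ.* (+ 3 ℤ.* (+ 1 ℤ.+ + 8 ℤ.* R)) ℤ.- + 5 ℤ.* (- + 1 ℤ.* (- + 1 ℤ.* + 1))
    ≡⟨ expand R ⟩
  (+ 1 ℤ.+ + 18 ℤ.* R) ℤ.* + 4
    ≡⟨ cong (ℤ._* + 4) (sym (pos-affine 1 18 (repunit 2 a))) ⟩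
  + (1 + 18 * repunit 2 a) ℤ.* + 4 ∎)
  where
  R = + repunit 2 a
  expand : ∀ R → + 3 ℤ.* (+ 3 ℤ.* (+ 1 ℤ.+ + 8 ℤ.* R)) ℤ.- + 5 ℤ.* (- + 1 ℤ.* (- + 1 ℤ.* + 1))
                 ≡ (+ 1 ℤ.+ + 18 ℤ.* R) ℤ.* + 4
  expand = ℤ-Ring.solve-∀

∣m⊖n∣≡∣m-n∣ : ∀ m n → ℤ.∣ m ⊖ n ∣ ≡ ∣ m - n ∣
∣m⊖n∣≡∣m-n∣ zero    zero    = refl
∣m⊖n∣≡∣m-n∣ zero    (suc n) = refl
∣m⊖n∣≡∣m-n∣ (suc m) zero    = refl
∣m⊖n∣≡∣m-n∣ (suc m) (suc n) = trans (cong ℤ.∣_∣ ([1+m]⊖[1+n]≡m⊖n m n)) (∣m⊖n∣≡∣m-n∣ m n)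

∣i-j∣≡∣m-n∣ : ∀ {i j m n} → i ≡ + m → j ≡ + n → ℤ.∣ i ℤ.- j ∣ ≡ ∣ m - n ∣
∣i-j∣≡∣m-n∣ {m = m} {n} refl refl = trans (cong ℤ.∣_∣ (m-n≡m⊖n m n)) (∣m⊖n∣≡∣m-n∣ m n)

2∤∣2+6x-1+18y∣ : ∀ x y → ¬ 2 ∣ ∣ 2 + 6 * x - 1 + 18 * y ∣
2∤∣2+6x-1+18y∣ x y 2∣∣-∣ = 2∤1+2n (9 * y) (subst (2 ∣_) (cong suc (*-assoc 2 9 y))
  (∣-∣-∣⇒∣ 2∣∣-∣ (∣m∣n⇒∣m+n ∣-refl (∣m⇒∣m*n x (divides 3 refl)))))

-- Stated for ℕ-divisibility of ℤ.∣_∣, which is how ℤ._∣_ is defined.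
u[1+k]-separates : ∀ m k l → k ≢ l → k < 2 ^ℕ suc m → l < 2 ^ℕ suc m →
  ¬ 2 ^ℕ suc m ∣ ℤ.∣ u (suc k) ℤ.- u (suc l) ∣
u[1+k]-separates m k l k≢l k< l< with half k | half l
... | even a | even b =
  affine-repunit-separates 2 1 2 m a b (k≢l ∘ cong (2 *_)) (*-cancelˡ-< 2 a _ k<) (*-cancelˡ-< 2 b _ l<)
  ∘ subst (2 ^ℕ suc m ∣_) (∣i-j∣≡∣m-n∣ (u[1+2a] a) (u[1+2a] b))
... | odd a  | odd b  =
  affine-repunit-separates 2 4 1 m a b (k≢l ∘ cong (λ x → 1 + 2 * x))
    (*-cancelˡ-< 2 a _ (<⇒≤ k<)) (*-cancelˡ-< 2 b _ (<⇒≤ l<))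
  ∘ subst (2 ^ℕ suc m ∣_) (∣i-j∣≡∣m-n∣ (u[2+2a] a) (u[2+2a] b))
... | even a | odd b  =
  2∤∣2+6x-1+18y∣ (repunit 2 a) (repunit 2 b) ∘ m*n∣⇒m∣ 2 (2 ^ℕ m)
  ∘ subst (2 ^ℕ suc m ∣_) (∣i-j∣≡∣m-n∣ (u[1+2a] a) (u[2+2a] b))
... | odd a  | even b =
  2∤∣2+6x-1+18y∣ (repunit 2 b) (repunit 2 a) ∘ m*n∣⇒m∣ 2 (2 ^ℕ m)
  ∘ subst (2 ^ℕ suc m ∣_) (trans (∣i-j∣≡∣m-n∣ (u[2+2a] a) (u[1+2a] b))
                                 (∣-∣-comm (1 + 18 * repunit 2 a) (2 + 6 * repunit 2 b)))

lemma2 : (n m : ℕ) → 2 ≤ n → n ≤ 2 ^ℕ m →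
         (i j : ℕ) → 1 ≤ i → i ≤ n → 1 ≤ j → j ≤ n → i ≢ j →
         ¬ ((+ (2 ^ℕ m)) ℤ.∣ (u i ℤ.- u j))
lemma2 n zero    2≤n n≤1        _       _       _ _   _ _   _   = ⊥-elim (<⇒≱ 2≤n n≤1)
lemma2 n (suc m) _   n≤2^[1+m] (suc k) (suc l) _ i≤n _ j≤n i≢j =
  u[1+k]-separates m k l (i≢j ∘ cong suc) (≤-trans i≤n n≤2^[1+m]) (≤-trans j≤n n≤2^[1+m])
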